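{- Let $p$ be an odd prime, $\zeta_p=e^{2\pi\sqrt{ -1}/p}$, and for $c\in\mathbb{Z}_p$ let $R_c=r_c^*r_c$ where $r_c=(\zeta_p^{cj})_{0\le j\le p-1}$ is a row vector. For $a\in\mathbb{Z}_p$ let $B_a$ be the $p^2\times p^2$ block-circulant matrix whose $(i,j)$ block ($0\le i,j\le p-1$) is $R_{(j-i)a}$, i.e. with first block row $[R_0,R_a,R_{2a},\dots,R_{(p-1)a}]$, all indices modulo $p$. Then for each $a\in\{1,\dots,p-1\}$, $B_a$ is a symmetric Bush-type matrix in $\operatorname{BH}(p^2,p)$. Furthermore $\overline{B_a}=B_{p-a}$ and $B_aB_{(p-2)a}=pB_{2a}=p\,\overline{B_{(p-2)a}}$ (subscripts of $B$ taken modulo $p$).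
   Context: $\operatorname{BH}(N,k)$ is the set of $N\times N$ matrices $H$ with entries in the $k$-th roots of unity and $HH^*=NI_N$. A matrix $H\in\operatorname{BH}(s^2,k)$ is of Bush-type if it can be partitioned into $s\times s$ blocks $H_{ij}$, $1\le i,j\le s$, with $JH_{ij}=H_{ij}J=\delta_{i,j}\,sJ$, where $J$ is the $s\times s$ all-ones matrix. $\overline{B}$ is the entrywise complex conjugate. -}

module Defs where

open import Data.Nat as ℕ using (ℕ; zero; suc; NonZero; _∸_)
open import Data.Nat.DivMod using (_mod_)
open import Data.Integer as ℤ using (ℤ; +_)
open import Data.Fin using (Fin; toℕ; combine; remQuot; _≟_)
open import Data.Product using (Σ; ∃; _×_; _,_)
open import Relation.Nullary using (does)
open import Data.Bool using (if_then_else_)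
open import Relation.Binary.PropositionalEquality using (_≡_)

sumℤ : ∀ {n} → (Fin n → ℤ) → ℤ
sumℤ {zero}  f = + 0
sumℤ {suc n} f = f Data.Fin.zero ℤ.+ sumℤ (λ i → f (Data.Fin.suc i))

-- The cyclotomic integers ℤ[ζ_p], ζ_p = e^{2πi/p}, p prime.
-- An element is represented by coefficients a : Fin p → ℤ standing for
-- Σ_t a(t) ζ^t, i.e. an element of the group ring ℤ[x]/(x^p - 1).
-- For p prime the kernel of ℤ[x]/(x^p-1) → ℤ[ζ_p] is ℤ·(1+x+…+x^{p-1}),
-- so two representatives are equal in ℤ[ζ_p] iff they differ by a
-- constant coefficient vector.

Cyc : ℕ → Set
Cyc p = Fin p → ℤ

module _ {p : ℕ} .{{_ : NonZero p}} where

  infix 4 _≈_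
  _≈_ : Cyc p → Cyc p → Set
  a ≈ b = ∃ λ (c : ℤ) → ∀ t → a t ℤ.- b t ≡ c

  ζ^ : ℕ → Cyc p
  ζ^ e t = if does (t ≟ (e mod p)) then + 1 else + 0

  0C : Cyc p
  0C t = + 0

  _+C_ : Cyc p → Cyc p → Cyc p
  (a +C b) t = a t ℤ.+ b t

  -- multiplication: convolution modulo x^p - 1
  _*C_ : Cyc p → Cyc p → Cyc p
  (a *C b) t = sumℤ (λ u → a u ℤ.* b ((toℕ t ℕ.+ (p ∸ toℕ u)) mod p))

  _·C_ : ℤ → Cyc p → Cyc p
  (n ·C a) t = n ℤ.* a t

  -- complex conjugation: ζ ↦ ζ^{-1}
  conjC : Cyc p → Cyc p
  conjC a t = a ((p ∸ toℕ t) mod p)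

  sumC : ∀ {n} → (Fin n → Cyc p) → Cyc p
  sumC {zero}  f = 0C
  sumC {suc n} f = f Data.Fin.zero +C sumC (λ i → f (Data.Fin.suc i))

  Mat : ℕ → Set
  Mat n = Fin n → Fin n → Cyc p

  infix 4 _≈M_
  _≈M_ : ∀ {n} → Mat n → Mat n → Set
  A ≈M B = ∀ i j → A i j ≈ B i j

  _*M_ : ∀ {n} → Mat n → Mat n → Mat n
  (A *M B) i j = sumC (λ k → A i k *C B k j)

  _·M_ : ∀ {n} → ℕ → Mat n → Mat n
  (m ·M A) i j = (+ m) ·C A i j

  conjM : ∀ {n} → Mat n → Mat n
  conjM A i j = conjC (A i j)

  transpose : ∀ {n} → Mat n → Mat n
  transpose A i j = A j i

  _ᴴ : ∀ {n} → Mat n → Mat n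
  (A ᴴ) i j = conjC (A j i)

  idM : ∀ {n} → Mat n
  idM i j = if does (i ≟ j) then ζ^ 0 else 0C

  allOnes : ∀ {n} → Mat n
  allOnes i j = ζ^ 0

  Symmetric : ∀ {n} → Mat n → Set
  Symmetric A = transpose A ≈M A

  BH : (N : ℕ) → Mat N → Set
  BH N H = (∀ i j → ∃ λ (e : Fin p) → H i j ≈ ζ^ (toℕ e))
         × ((H *M (H ᴴ)) ≈M (N ·M idM))

  -- the (i,j) s×s block of an s²×s² matrix (row index combine i u = i·s+u)
  block : (s : ℕ) → Mat (s ℕ.* s) → Fin s → Fin s → Mat s
  block s H i j u v = H (combine {s} {s} i u) (combine {s} {s} j v)

  δ : ∀ {s} → Fin s → Fin s → ℕ
  δ i j = if does (i ≟ j) then 1 else 0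

  BushType : (s : ℕ) → Mat (s ℕ.* s) → Set
  BushType s H = ∀ i j →
      ((allOnes *M block s H i j) ≈M (δ i j ·M (s ·M allOnes)))
    × ((block s H i j *M allOnes) ≈M (δ i j ·M (s ·M allOnes)))

  r : ℕ → Fin p → Cyc p
  r c j = ζ^ (c ℕ.* toℕ j)

  R : ℕ → Mat p
  R c j l = conjC (r c j) *C r c l

  B : ℕ → Mat (p ℕ.* p)
  B a x y with remQuot {p} p x | remQuot {p} p y
  ... | I , j | J , l = R (((toℕ J ℕ.+ (p ∸ toℕ I)) ℕ.* a) ℕ.% p) j l

{-# OPTIONS --safe #-}
module Submission where

-- Every entry of B_b is a root of unity: the entry in row (I, j) and column (J, l) is
-- ζ^((J - I) b (l - j)).  Over the field ℤ/p a character sum Σ_k ζ^(α k + β) is p ζ^β when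
-- α ≡ 0 and 1 + ζ + … + ζ^(p-1) = 0 otherwise, and every product in the statement is a sum of
-- this kind.  In J H_IJ and H_IJ J the slope is ±b (J - I).  In B_b B_b^* the inner sum over k has
-- slope b (J - I) and the remaining sum over K has slope b (l - j), so only the diagonal survives.
-- In B_b B_(p-2)b, where (p - 2) b ≡ -2b, the slope is b (2J - I - K): the single block K ≡ 2J - I
-- contributes p ζ^(2b (J - I)(l - j)) and every other K a constant.  Symmetry and the two
-- conjugation identities are congruences between exponents.

open import Defs
open import Data.Bool.Base using (if_then_else_)
open import Data.Fin.Base as Fin using (Fin; toℕ; fromℕ<; combine; _↑ˡ_; _↑ʳ_)
open import Data.Fin.Properties
  using ( _≟_; suc-injective; toℕ-injective; toℕ-fromℕ<; fromℕ<-cong; toℕ<n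
        ; combine-surjective; combine-injective; remQuot-combine)
open import Data.Integer.Base using (ℤ; +_; 0ℤ; 1ℤ; _+_; _-_; _*_; -_; ∣_∣; _⊖_; _%ℕ_; _/ℕ_)
import Data.Integer.Properties as ℤ
open import Data.Integer.DivMod using (n%ℕd<d; a≡a%ℕn+[a/ℕn]*n)
open import Data.Integer.Divisibility.Signed
  using (_∣_; divides; ∣m⇒∣-m; ∣m∣n⇒∣m+n; ∣m⇒∣m*n; ∣n⇒∣m*n; ∣⇒∣ᵤ; ∣ᵤ⇒∣)
open import Data.Integer.Tactic.RingSolver using (solve; solve-∀)
open import Data.List.Base using (_∷_; [])
open import Data.Nat.Base as ℕ using (ℕ; zero; suc; NonZero; _∸_)
import Data.Nat.Properties as ℕ
import Data.Nat.Divisibility as ℕ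
open import Data.Nat.DivMod using (_mod_)
open import Data.Nat.Coprimality using (Coprime; prime⇒coprime; coprime-Bézout)
open import Data.Nat.GCD using (module Bézout)
open import Data.Nat.Primality using (Prime; euclidsLemma; prime⇒nonTrivial)
open import Data.Product.Base using (∃; ∃₂; _×_; _,_; proj₁; proj₂)
open import Data.Sum.Base using (inj₁; inj₂)
open import Function.Base using (_∘_)
open import Level using (0ℓ)
open import Relation.Binary.Bundles using (Setoid)
open import Relation.Binary.Structures using (IsEquivalence)
import Relation.Binary.Reasoning.Setoid as SetoidReasoning
open import Relation.Binary.PropositionalEquality
open import Relation.Nullary using (¬_; Dec; yes; no; does; contradiction)
open import Relation.Nullary.Decidable using (dec-true; dec-false)

ι : ∀ {n} → Fin n → ℤ
ι i = + toℕ i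

prime⇒2≤p : ∀ {p} → Prime p → 2 ℕ.≤ p
prime⇒2≤p {p} p-prime = ℕ.nonTrivial⇒n>1 p {{prime⇒nonTrivial p-prime}}

pos-1+* : ∀ a b c d → 1 ℕ.+ a ℕ.* b ≡ c ℕ.* d → 1ℤ + + a * + b ≡ + c * + d
pos-1+* a b c d eq =
  trans (cong (λ z → 1ℤ + z) (sym (ℤ.pos-* a b))) (trans (cong +_ eq) (ℤ.pos-* c d))

bézoutℤ : ∀ {m n} → Coprime m n → ∃₂ λ u v → u * + m + v * + n ≡ 1ℤ
bézoutℤ {m} {n} m⊥n with coprime-Bézout m⊥n
... | Bézout.+- x y 1+yn≡xm =
  + x , - + y ,
  trans (cong (λ z → z + - + y * + n) (sym (pos-1+* y n x m 1+yn≡xm))) (ring₁ (+ y) (+ n))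
  where
  ring₁ : ∀ Y N → 1ℤ + Y * N + - Y * N ≡ 1ℤ
  ring₁ = solve-∀
... | Bézout.-+ x y 1+xm≡yn =
  - + x , + y ,
  trans (cong (λ z → - + x * + m + z) (sym (pos-1+* x m y n 1+xm≡yn))) (ring₂ (+ x) (+ m))
  where
  ring₂ : ∀ X M → - X * M + (1ℤ + X * M) ≡ 1ℤ
  ring₂ = solve-∀

sumℤ-cong : ∀ {n} {f g : Fin n → ℤ} → (∀ i → f i ≡ g i) → sumℤ f ≡ sumℤ g
sumℤ-cong {zero}  f≗g = refl
sumℤ-cong {suc n} f≗g = cong₂ _+_ (f≗g Fin.zero) (sumℤ-cong (f≗g ∘ Fin.suc))

sumℤ-const : ∀ n x → sumℤ {n} (λ _ → x) ≡ + n * x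
sumℤ-const zero    x = refl
sumℤ-const (suc n) x = trans (cong (λ s → x + s) (sumℤ-const n x)) (ring x (+ n))
  where
  ring : ∀ X N → X + N * X ≡ (1ℤ + N) * X
  ring = solve-∀

sumℤ-*ˡ : ∀ {n} x (f : Fin n → ℤ) → sumℤ (λ i → x * f i) ≡ x * sumℤ f
sumℤ-*ˡ {zero}  x f = sym (ℤ.*-zeroʳ x)
sumℤ-*ˡ {suc n} x f =
  trans (cong (λ s → x * f Fin.zero + s) (sumℤ-*ˡ x (f ∘ Fin.suc))) (sym (ℤ.*-distribˡ-+ x _ _))

sumℤ-+ : ∀ {n} (f g : Fin n → ℤ) → sumℤ (λ i → f i + g i) ≡ sumℤ f + sumℤ g
sumℤ-+ {zero}  f g = refl
sumℤ-+ {suc n} f g =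
  trans (cong (λ s → f Fin.zero + g Fin.zero + s) (sumℤ-+ (f ∘ Fin.suc) (g ∘ Fin.suc)))
        (ring (f Fin.zero) (g Fin.zero) _ _)
  where
  ring : ∀ a b c d → a + b + (c + d) ≡ a + c + (b + d)
  ring = solve-∀

sumℤ-single : ∀ {n} (f : Fin n → ℤ) k → (∀ i → i ≢ k → f i ≡ 0ℤ) → sumℤ f ≡ f k
sumℤ-single {suc n} f Fin.zero others≡0 =
  trans (cong (λ s → f Fin.zero + s) tail≡0) (ℤ.+-identityʳ _)
  where
  tail≡0 : sumℤ (f ∘ Fin.suc) ≡ 0ℤ
  tail≡0 = trans (sumℤ-cong (λ i → others≡0 (Fin.suc i) λ ())) (trans (sumℤ-const n 0ℤ) (ℤ.*-zeroʳ (+ n)))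
sumℤ-single {suc n} f (Fin.suc k) others≡0 =
  trans (cong₂ _+_ (others≡0 Fin.zero λ ()) (sumℤ-single (f ∘ Fin.suc) k tail-others≡0)) (ℤ.+-identityˡ _)
  where
  tail-others≡0 : ∀ i → i ≢ k → f (Fin.suc i) ≡ 0ℤ
  tail-others≡0 i i≢k = others≡0 (Fin.suc i) (i≢k ∘ suc-injective)

sumℤ-except : ∀ {n} (f : Fin n → ℤ) k c → (∀ i → i ≢ k → f i ≡ c) → sumℤ f ≡ f k + (+ n * c - c)
sumℤ-except {n} f k c others≡c = begin
  sumℤ f                                     ≡⟨ sumℤ-cong (λ i → ring₁ (f i) c) ⟩
  sumℤ (λ i → (f i - c) + c)                 ≡⟨ sumℤ-+ (λ i → f i - c) (λ _ → c) ⟩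
  sumℤ (λ i → f i - c) + sumℤ {n} (λ _ → c)
    ≡⟨ cong₂ _+_ (sumℤ-single (λ i → f i - c) k shifted≡0) (sumℤ-const n c) ⟩
  (f k - c) + + n * c                        ≡⟨ ring₂ (f k) c (+ n) ⟩
  f k + (+ n * c - c)                        ∎
  where
  open ≡-Reasoning
  ring₁ : ∀ F C → F ≡ (F - C) + C
  ring₁ = solve-∀
  ring₂ : ∀ F C N → (F - C) + N * C ≡ F + (N * C - C)
  ring₂ = solve-∀
  shifted≡0 : ∀ i → i ≢ k → f i - c ≡ 0ℤ
  shifted≡0 i i≢k = trans (cong (_- c) (others≡c i i≢k)) (ℤ.+-inverseʳ c)

sumℤ-++ : ∀ m n (f : Fin (m ℕ.+ n) → ℤ) →
          sumℤ f ≡ sumℤ (λ i → f (i ↑ˡ n)) + sumℤ (λ j → f (m ↑ʳ j))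
sumℤ-++ zero    n f = sym (ℤ.+-identityˡ _)
sumℤ-++ (suc m) n f =
  trans (cong (λ s → f Fin.zero + s) (sumℤ-++ m n (f ∘ Fin.suc))) (sym (ℤ.+-assoc (f Fin.zero) _ _))

sumℤ-combine : ∀ m n (f : Fin (m ℕ.* n) → ℤ) →
               sumℤ f ≡ sumℤ {m} (λ i → sumℤ {n} (λ j → f (combine i j)))
sumℤ-combine zero    n f = refl
sumℤ-combine (suc m) n f = trans (sumℤ-++ n (m ℕ.* n) f)
  (cong (λ s → sumℤ (λ j → f (j ↑ˡ (m ℕ.* n))) + s) (sumℤ-combine m n (f ∘ (n ↑ʳ_))))

∀-combine : ∀ {m n} {P : Fin (m ℕ.* n) → Fin (m ℕ.* n) → Set} →
            (∀ I j J l → P (combine I j) (combine J l)) → ∀ x y → P x y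
∀-combine {m} {n} P-combine x y with combine-surjective {m} {n} x | combine-surjective {m} {n} y
... | I , j , refl | J , l , refl = P-combine I j J l

module ModularArithmetic (p : ℕ) where

  infix 4 _≡ₚ_ _≢ₚ_

  -- A record rather than + p ∣ x - y itself, so that x and y can be inferred.
  record _≡ₚ_ (x y : ℤ) : Set where
    constructor congruent
    field divides-difference : + p ∣ x - y

  _≢ₚ_ : ℤ → ℤ → Set
  x ≢ₚ y = ¬ x ≡ₚ y

  private
    ∣-resp : ∀ {x y} → + p ∣ x → x ≡ y → + p ∣ y
    ∣-resp h refl = h

  ≡ₚ-reflexive : ∀ {x y} → x ≡ y → x ≡ₚ y
  ≡ₚ-reflexive {x} refl = congruent (divides 0ℤ (ℤ.+-inverseʳ x))

  ≡ₚ-refl : ∀ {x} → x ≡ₚ x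
  ≡ₚ-refl {x} = ≡ₚ-reflexive {x} refl

  ≡ₚ-sym : ∀ {x y} → x ≡ₚ y → y ≡ₚ x
  ≡ₚ-sym {x} {y} (congruent h) = congruent (∣-resp (∣m⇒∣-m h) (solve (x ∷ y ∷ [])))

  ≡ₚ-trans : ∀ {x y z} → x ≡ₚ y → y ≡ₚ z → x ≡ₚ z
  ≡ₚ-trans {x} {y} {z} (congruent h) (congruent g) =
    congruent (∣-resp (∣m∣n⇒∣m+n h g) (solve (x ∷ y ∷ z ∷ [])))

  ≡ₚ-isEquivalence : IsEquivalence _≡ₚ_
  ≡ₚ-isEquivalence = record { refl = ≡ₚ-refl ; sym = ≡ₚ-sym ; trans = ≡ₚ-trans }

  ≡ₚ-setoid : Setoid 0ℓ 0ℓ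
  ≡ₚ-setoid = record { isEquivalence = ≡ₚ-isEquivalence }

  module ≡ₚ-Reasoning = SetoidReasoning ≡ₚ-setoid

  ≡ₚ-transfer : ∀ {x y u v} → x - u ≡ₚ y - v → u ≡ₚ x → v ≡ₚ y
  ≡ₚ-transfer {x} {y} {u} {v} (congruent h) (congruent g) =
    congruent (∣-resp (∣m∣n⇒∣m+n g h) (solve (x ∷ y ∷ u ∷ v ∷ [])))

  ∣⇒≡ₚ0 : ∀ {x} → + p ∣ x → x ≡ₚ 0ℤ
  ∣⇒≡ₚ0 {x} h = congruent (∣-resp h (sym (ℤ.+-identityʳ x)))

  ≡ₚ0⇒∣ : ∀ {x} → x ≡ₚ 0ℤ → + p ∣ x
  ≡ₚ0⇒∣ {x} (congruent h) = ∣-resp h (ℤ.+-identityʳ x)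

  ≡ₚ-byFactor : ∀ {x y u v} w → x - y ≡ (u - v) * w → u ≡ₚ v → x ≡ₚ y
  ≡ₚ-byFactor w eq (congruent u≡v) = congruent (∣-resp (∣m⇒∣m*n w u≡v) (sym eq))

  +-congₚ : ∀ {x x′ y y′} → x ≡ₚ x′ → y ≡ₚ y′ → x + y ≡ₚ x′ + y′
  +-congₚ {x} {x′} {y} {y′} (congruent h) (congruent g) =
    congruent (∣-resp (∣m∣n⇒∣m+n h g) (solve (x ∷ x′ ∷ y ∷ y′ ∷ [])))

  *-congₚ : ∀ {x x′ y y′} → x ≡ₚ x′ → y ≡ₚ y′ → x * y ≡ₚ x′ * y′
  *-congₚ {x} {x′} {y} {y′} (congruent h) (congruent g) =
    congruent (∣-resp (∣m∣n⇒∣m+n (∣m⇒∣m*n y h) (∣n⇒∣m*n x′ g)) (solve (x ∷ x′ ∷ y ∷ y′ ∷ [])))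

  -‿congₚ : ∀ {x x′} → x ≡ₚ x′ → - x ≡ₚ - x′
  -‿congₚ {x} {x′} (congruent h) = congruent (∣-resp (∣m⇒∣-m h) (solve (x ∷ x′ ∷ [])))

  p∸m≡ₚ-m : ∀ {m} → m ℕ.≤ p → + (p ∸ m) ≡ₚ - + m
  p∸m≡ₚ-m {m} m≤p = congruent (divides 1ℤ (begin
    + (p ∸ m) - - + m  ≡⟨ cong (_- - + m) (sym (ℤ.⊖-≥ m≤p)) ⟩
    p ⊖ m - - + m      ≡⟨ cong (_- - + m) (sym (ℤ.m-n≡m⊖n p m)) ⟩
    + p - + m - - + m  ≡⟨ ring (+ p) (+ m) ⟩
    1ℤ * + p           ∎))
    where
    open ≡-Reasoning
    ring : ∀ P M → P - M - - M ≡ 1ℤ * P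
    ring = solve-∀

  m+[p∸n]≡ₚm-n : ∀ m {n} → n ℕ.≤ p → + (m ℕ.+ (p ∸ n)) ≡ₚ + m - + n
  m+[p∸n]≡ₚm-n m n≤p = +-congₚ (≡ₚ-refl {+ m}) (p∸m≡ₚ-m n≤p)

  toℕ-≡ₚ-injective : ∀ {s t : Fin p} → ι s ≡ₚ ι t → s ≡ t
  toℕ-≡ₚ-injective {s} {t} (congruent s≡t) = toℕ-injective (ℤ.+-injective
    (ℤ.i-j≡0⇒i≡j (ι s) (ι t) (ℤ.∣i∣≡0⇒i≡0 (multiple<p⇒0 distance<p (∣⇒∣ᵤ s≡t)))))
    where
    multiple<p⇒0 : ∀ {d} → d ℕ.< p → p ℕ.∣ d → d ≡ 0
    multiple<p⇒0 {zero}  _   _   = refl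
    multiple<p⇒0 {suc _} d<p p∣d = contradiction p∣d (ℕ.>⇒∤ d<p)
    distance<p : ∣ ι s - ι t ∣ ℕ.< p
    distance<p = begin-strict
      ∣ ι s - ι t ∣          ≡⟨ cong ∣_∣ (ℤ.m-n≡m⊖n (toℕ s) (toℕ t)) ⟩
      ∣ toℕ s ⊖ toℕ t ∣      ≤⟨ ℤ.∣m⊝n∣≤m⊔n (toℕ s) (toℕ t) ⟩
      toℕ s ℕ.⊔ toℕ t        <⟨ ℕ.⊔-lub (toℕ<n s) (toℕ<n t) ⟩
      p                      ∎
      where open ℕ.≤-Reasoning

  ι-≢ₚ : ∀ {s t : Fin p} → s ≢ t → ι s - ι t ≢ₚ 0ℤ
  ι-≢ₚ s≢t s-t≡0 = s≢t (toℕ-≡ₚ-injective (congruent (≡ₚ0⇒∣ s-t≡0)))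

  0<m<p⇒≢ₚ0 : ∀ {m} → 0 ℕ.< m → m ℕ.< p → + m ≢ₚ 0ℤ
  0<m<p⇒≢ₚ0 {m} 0<m m<p m≡0 = ℕ.>⇒∤ {{ℕ.>-nonZero 0<m}} m<p (∣⇒∣ᵤ (≡ₚ0⇒∣ m≡0))

  module _ .{{_ : NonZero p}} where

    %ℕ-≡ₚ : ∀ x → + (x %ℕ p) ≡ₚ x
    %ℕ-≡ₚ x = congruent (divides (- (x /ℕ p)) (begin
      + (x %ℕ p) - x                              ≡⟨ cong (λ y → + (x %ℕ p) - y) (a≡a%ℕn+[a/ℕn]*n x p) ⟩
      + (x %ℕ p) - (+ (x %ℕ p) + (x /ℕ p) * + p)  ≡⟨ ring (+ (x %ℕ p)) (x /ℕ p) (+ p) ⟩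
      - (x /ℕ p) * + p                            ∎))
      where
      open ≡-Reasoning
      ring : ∀ r q P → r - (r + q * P) ≡ - q * P
      ring = solve-∀

    residue : ℤ → Fin p
    residue x = fromℕ< (n%ℕd<d x p)

    residue-≡ₚ : ∀ x → ι (residue x) ≡ₚ x
    residue-≡ₚ x rewrite toℕ-fromℕ< (n%ℕd<d x p) = %ℕ-≡ₚ x

    ≡ₚ⇒≡residue : ∀ {s x} → ι s ≡ₚ x → s ≡ residue x
    ≡ₚ⇒≡residue s≡x = toℕ-≡ₚ-injective (≡ₚ-trans s≡x (≡ₚ-sym (residue-≡ₚ _)))

    residue-cong : ∀ {x y} → x ≡ₚ y → residue x ≡ residue y
    residue-cong {x} x≡y = ≡ₚ⇒≡residue (≡ₚ-trans (residue-≡ₚ x) x≡y)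

    ≡residue⇒≡ₚ : ∀ {s x} → s ≡ residue x → ι s ≡ₚ x
    ≡residue⇒≡ₚ {x = x} refl = residue-≡ₚ x

    mod≡residue : ∀ n → n mod p ≡ residue (+ n)
    mod≡residue n = fromℕ<-cong _ _ refl _ _

    ι-mod-≡ₚ : ∀ n → ι (n mod p) ≡ₚ + n
    ι-mod-≡ₚ n rewrite mod≡residue n = residue-≡ₚ (+ n)

  module _ (p-prime : Prime p) where

    *-cancelˡ-≡ₚ0 : ∀ {x y} → x ≢ₚ 0ℤ → x * y ≡ₚ 0ℤ → y ≡ₚ 0ℤ
    *-cancelˡ-≡ₚ0 {x} {y} x≢0 xy≡0
      with euclidsLemma ∣ x ∣ ∣ y ∣ p-prime (subst (p ℕ.∣_) (ℤ.abs-* x y) (∣⇒∣ᵤ (≡ₚ0⇒∣ xy≡0)))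
    ... | inj₁ p∣x = contradiction (∣⇒≡ₚ0 (∣ᵤ⇒∣ p∣x)) x≢0
    ... | inj₂ p∣y = ∣⇒≡ₚ0 (∣ᵤ⇒∣ p∣y)

    *-≢ₚ0 : ∀ {x y} → x ≢ₚ 0ℤ → y ≢ₚ 0ℤ → x * y ≢ₚ 0ℤ
    *-≢ₚ0 x≢0 y≢0 xy≡0 = y≢0 (*-cancelˡ-≡ₚ0 x≢0 xy≡0)

    module _ .{{_ : NonZero p}} where

      inverse-≡ₚ : ∀ {x} → x ≢ₚ 0ℤ → ∃ λ y → y * x ≡ₚ 1ℤ
      inverse-≡ₚ {x} x≢0 = invert (x %ℕ p) (n%ℕd<d x p) (%ℕ-≡ₚ x)
        where
        open ≡ₚ-Reasoning
        ring : ∀ U V M P → V * M - (U * P + V * M) ≡ - U * P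
        ring = solve-∀
        invert : ∀ m → m ℕ.< p → + m ≡ₚ x → ∃ λ y → y * x ≡ₚ 1ℤ
        invert zero      _   0≡x = contradiction (≡ₚ-sym 0≡x) x≢0
        invert m@(suc _) m<p m≡x with bézoutℤ (prime⇒coprime p-prime m<p)
        ... | u , v , up+vm≡1 = v , (begin
          v * x    ≈⟨ *-congₚ (≡ₚ-refl {v}) (≡ₚ-sym m≡x) ⟩
          v * + m  ≈⟨ congruent (divides (- u) (trans (cong (λ z → v * + m - z) (sym up+vm≡1))
                                                      (ring u v (+ m) (+ p)))) ⟩
          1ℤ       ∎)

      affine-injective : ∀ {α β} {u v : Fin p} → α ≢ₚ 0ℤ → α * ι u + β ≡ₚ α * ι v + β → u ≡ v
      affine-injective {α} {β} {u} {v} α≢0 (congruent h) =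
        toℕ-≡ₚ-injective (congruent (≡ₚ0⇒∣ (*-cancelˡ-≡ₚ0 α≢0 α[u-v]≡0)))
        where
        ring : ∀ A B U V → A * U + B - (A * V + B) ≡ A * (U - V)
        ring = solve-∀
        α[u-v]≡0 : α * (ι u - ι v) ≡ₚ 0ℤ
        α[u-v]≡0 = ∣⇒≡ₚ0 (∣-resp h (ring α β (ι u) (ι v)))

      -- Opaque: unfolding the witness would make the type checker run the Bézout computation.
      opaque
        affine-surjective : ∀ {α} β → α ≢ₚ 0ℤ → ∀ x → ∃ λ (k : Fin p) → α * ι k + β ≡ₚ x
        affine-surjective {α} β α≢0 x with inverse-≡ₚ α≢0
        ... | γ , γα≡1 = residue (γ * (x - β)) , (begin
          α * ι (residue (γ * (x - β))) + β
            ≈⟨ +-congₚ (*-congₚ (≡ₚ-refl {α}) (residue-≡ₚ _)) (≡ₚ-refl {β}) ⟩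
          α * (γ * (x - β)) + β              ≡⟨ ring₁ α γ (x - β) β ⟩
          γ * α * (x - β) + β                ≈⟨ +-congₚ (*-congₚ γα≡1 (≡ₚ-refl {x - β})) (≡ₚ-refl {β}) ⟩
          1ℤ * (x - β) + β                   ≡⟨ ring₂ x β ⟩
          x                                  ∎)
          where
          open ≡ₚ-Reasoning
          ring₁ : ∀ A G Y B → A * (G * Y) + B ≡ G * A * Y + B
          ring₁ = solve-∀
          ring₂ : ∀ X B → 1ℤ * (X - B) + B ≡ X
          ring₂ = solve-∀

module Monomials (p : ℕ) .{{_ : NonZero p}} where
  open ModularArithmetic p

  -- Opaque so that unification can recover x and t from ζ^ℤ x t.
  opaque
    ζ^ℤ : ℤ → Cyc p
    ζ^ℤ x t = if does (t ≟ residue x) then + 1 else + 0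

  opaque
    unfolding ζ^ℤ

    ζ^≡ζ^ℤ : ∀ n → ζ^ n ≡ ζ^ℤ (+ n)
    ζ^≡ζ^ℤ n = cong (λ s t → if does (t ≟ s) then + 1 else + 0) (mod≡residue n)

    ζ^ℤ-cong : ∀ {x y} → x ≡ₚ y → ζ^ℤ x ≡ ζ^ℤ y
    ζ^ℤ-cong x≡y = cong (λ s t → if does (t ≟ s) then + 1 else + 0) (residue-cong x≡y)

    ζ^ℤ-at : ∀ {x t} → t ≡ residue x → ζ^ℤ x t ≡ 1ℤ
    ζ^ℤ-at {x} {t} t≡x = cong (if_then + 1 else + 0) (dec-true (t ≟ residue x) t≡x)

    ζ^ℤ-off : ∀ {x t} → t ≢ residue x → ζ^ℤ x t ≡ 0ℤ
    ζ^ℤ-off {x} {t} t≢x = cong (if_then + 1 else + 0) (dec-false (t ≟ residue x) t≢x)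

    ζ^ℤ-resp : ∀ {x y s t} → (ι s ≡ₚ x → ι t ≡ₚ y) → (ι t ≡ₚ y → ι s ≡ₚ x) →
               ζ^ℤ x s ≡ ζ^ℤ y t
    ζ^ℤ-resp {x} {y} {s} {t} to from with s ≟ residue x | t ≟ residue y
    ... | yes _   | yes _   = refl
    ... | no _    | no _    = refl
    ... | yes s≡x | no t≢y  = contradiction (≡ₚ⇒≡residue (to (≡residue⇒≡ₚ s≡x))) t≢y
    ... | no s≢x  | yes t≡y = contradiction (≡ₚ⇒≡residue (from (≡residue⇒≡ₚ t≡y))) s≢x

  ζ^ℤ-shift : ∀ {x y s t} → x - ι s ≡ₚ y - ι t → ζ^ℤ x s ≡ ζ^ℤ y t
  ζ^ℤ-shift h = ζ^ℤ-resp (≡ₚ-transfer h) (≡ₚ-transfer (≡ₚ-sym h))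

  ι-mod-negate : ∀ (t : Fin p) → ι ((p ∸ toℕ t) mod p) ≡ₚ - ι t
  ι-mod-negate t = ≡ₚ-trans (ι-mod-≡ₚ _) (p∸m≡ₚ-m (ℕ.<⇒≤ (toℕ<n t)))

  ι-mod-minus : ∀ (t u : Fin p) → ι ((toℕ t ℕ.+ (p ∸ toℕ u)) mod p) ≡ₚ ι t - ι u
  ι-mod-minus t u = ≡ₚ-trans (ι-mod-≡ₚ _) (m+[p∸n]≡ₚm-n (toℕ t) (ℕ.<⇒≤ (toℕ<n u)))

  conjC-ζ^ℤ : ∀ x → conjC (ζ^ℤ x) ≗ ζ^ℤ (- x)
  conjC-ζ^ℤ x t = ζ^ℤ-resp to from
    where
    open ≡ₚ-Reasoning
    to : ι ((p ∸ toℕ t) mod p) ≡ₚ x → ι t ≡ₚ - x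
    to s≡x = begin
      ι t                            ≡⟨ ℤ.neg-involutive (ι t) ⟨
      - - ι t                        ≈⟨ -‿congₚ (ι-mod-negate t) ⟨
      - ι ((p ∸ toℕ t) mod p)        ≈⟨ -‿congₚ s≡x ⟩
      - x                            ∎
    from : ι t ≡ₚ - x → ι ((p ∸ toℕ t) mod p) ≡ₚ x
    from t≡-x = begin
      ι ((p ∸ toℕ t) mod p)          ≈⟨ ι-mod-negate t ⟩
      - ι t                          ≈⟨ -‿congₚ t≡-x ⟩
      - - x                          ≡⟨ ℤ.neg-involutive x ⟩
      x                              ∎

  *C-ζ^ℤ : ∀ x y → ζ^ℤ x *C ζ^ℤ y ≗ ζ^ℤ (x + y)
  *C-ζ^ℤ x y t = begin
    sumℤ (λ u → ζ^ℤ x u * ζ^ℤ y (index u))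
      ≡⟨ sumℤ-single _ (residue x) (λ u u≢x → cong (_* ζ^ℤ y (index u)) (ζ^ℤ-off u≢x)) ⟩
    ζ^ℤ x (residue x) * ζ^ℤ y (index (residue x))   ≡⟨ cong (_* ζ^ℤ y (index (residue x))) (ζ^ℤ-at refl) ⟩
    1ℤ * ζ^ℤ y (index (residue x))                  ≡⟨ ℤ.*-identityˡ _ ⟩
    ζ^ℤ y (index (residue x))                       ≡⟨ ζ^ℤ-shift exponents ⟩
    ζ^ℤ (x + y) t                                   ∎
    where
    open ≡-Reasoning
    index : Fin p → Fin p
    index u = (toℕ t ℕ.+ (p ∸ toℕ u)) mod p
    ring : ∀ X Y T → Y - (T - X) ≡ X + Y - T
    ring = solve-∀
    index≡t-x : ι (index (residue x)) ≡ₚ ι t - x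
    index≡t-x = ≡ₚ-trans (ι-mod-minus t (residue x)) (+-congₚ (≡ₚ-refl {ι t}) (-‿congₚ (residue-≡ₚ x)))
    exponents : y - ι (index (residue x)) ≡ₚ x + y - ι t
    exponents = ≡ₚ-trans (+-congₚ (≡ₚ-refl {y}) (-‿congₚ index≡t-x)) (≡ₚ-reflexive (ring x y (ι t)))

  sum-ζ^ℤ-constant : ∀ {e : Fin p → ℤ} {β} → (∀ k → e k ≡ₚ β) →
                     ∀ t → sumℤ (λ k → ζ^ℤ (e k) t) ≡ + p * ζ^ℤ β t
  sum-ζ^ℤ-constant {β = β} e≡β t =
    trans (sumℤ-cong (λ k → cong (λ f → f t) (ζ^ℤ-cong (e≡β k)))) (sumℤ-const p (ζ^ℤ β t))

  sum-ζ^ℤ-affine : Prime p → ∀ {e : Fin p → ℤ} {α β} → α ≢ₚ 0ℤ → (∀ k → e k ≡ₚ α * ι k + β) →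
                   ∀ t → sumℤ (λ k → ζ^ℤ (e k) t) ≡ 1ℤ
  sum-ζ^ℤ-affine p-prime {e} {α} {β} α≢0 e≡ t with affine-surjective p-prime β α≢0 (ι t)
  ... | k , k↦t =
    trans (sumℤ-single _ k others) (ζ^ℤ-at (≡ₚ⇒≡residue (≡ₚ-sym (≡ₚ-trans (e≡ k) k↦t))))
    where
    others : ∀ u → u ≢ k → ζ^ℤ (e u) t ≡ 0ℤ
    others u u≢k = ζ^ℤ-off λ t≡eu → u≢k (affine-injective p-prime α≢0
      (≡ₚ-trans (≡ₚ-sym (e≡ u)) (≡ₚ-trans (≡ₚ-sym (≡residue⇒≡ₚ t≡eu)) (≡ₚ-sym k↦t))))

  ≗⇒≈ : ∀ {u v : Cyc p} → u ≗ v → u ≈ v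
  ≗⇒≈ {u} {v} u≗v = 0ℤ , λ t → trans (cong (_- v t) (u≗v t)) (ℤ.+-inverseʳ (v t))

  ≡+c⇒≈ : ∀ {u v : Cyc p} c → (∀ t → u t ≡ v t + c) → u ≈ v
  ≡+c⇒≈ {u} {v} c u≡v+c = c , λ t → trans (cong (_- v t) (u≡v+c t)) (ring (v t) c)
    where
    ring : ∀ V C → V + C - V ≡ C
    ring = solve-∀

  constant-≈ : ∀ {u v : Cyc p} {c d} → (∀ t → u t ≡ c) → (∀ t → v t ≡ d) → u ≈ v
  constant-≈ {c = c} {d} u≡c v≡d = c - d , λ t → cong₂ _-_ (u≡c t) (v≡d t)

  ≗M⇒≈M : ∀ {n} {A C : Mat n} → (∀ i j → A i j ≗ C i j) → A ≈M C
  ≗M⇒≈M A≗C i j = ≗⇒≈ (A≗C i j)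

  idM-diagonal : ∀ {n} (x : Fin n) → idM x x ≡ ζ^ 0
  idM-diagonal x = cong (if_then ζ^ 0 else 0C) (dec-true (x ≟ x) refl)

  idM-offDiagonal : ∀ {n} {x y : Fin n} → x ≢ y → idM x y ≡ 0C
  idM-offDiagonal {x = x} {y} x≢y = cong (if_then ζ^ 0 else 0C) (dec-false (x ≟ y) x≢y)

  δ-diagonal : ∀ {n} (i : Fin n) → δ i i ≡ 1
  δ-diagonal i = cong (if_then 1 else 0) (dec-true (i ≟ i) refl)

  δ-offDiagonal : ∀ {n} {i j : Fin n} → i ≢ j → δ i j ≡ 0
  δ-offDiagonal {i = i} {j} i≢j = cong (if_then 1 else 0) (dec-false (i ≟ j) i≢j)

  sumC-apply : ∀ {n} (f : Fin n → Cyc p) t → sumC f t ≡ sumℤ (λ k → f k t)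
  sumC-apply {zero}  f t = refl
  sumC-apply {suc n} f t = cong (λ s → f Fin.zero t + s) (sumC-apply (f ∘ Fin.suc) t)

  *C-congˡ : ∀ {u u′ v : Cyc p} → u ≗ u′ → u *C v ≗ u′ *C v
  *C-congˡ {v = v} u≗u′ t = sumℤ-cong (λ k → cong (_* v _) (u≗u′ k))

  *C-cong : ∀ {u u′ v v′ : Cyc p} → u ≗ u′ → v ≗ v′ → u *C v ≗ u′ *C v′
  *C-cong u≗u′ v≗v′ t = sumℤ-cong (λ k → cong₂ _*_ (u≗u′ k) (v≗v′ _))

  -- Records, so that the matrix and its exponents can be inferred from a proof.
  record Monomial {n} (A : Mat n) (E : Fin n → Fin n → ℤ) : Set where
    constructor monomial
    field entries : ∀ i j → A i j ≗ ζ^ℤ (E i j)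
  open Monomial

  allOnes-monomial : ∀ {n} → Monomial (allOnes {n = n}) (λ _ _ → 0ℤ)
  allOnes-monomial = monomial λ i j t → cong (λ f → f t) (ζ^≡ζ^ℤ 0)

  *M-monomial : ∀ {n} {A C : Mat n} {E F} → Monomial A E → Monomial C F →
                ∀ i j t → (A *M C) i j t ≡ sumℤ (λ k → ζ^ℤ (E i k + F k j) t)
  *M-monomial {A = A} {C} {E} {F} A-mono C-mono i j t = trans (sumC-apply (λ k → A i k *C C k j) t)
    (sumℤ-cong λ k → trans (*C-cong (entries A-mono i k) (entries C-mono k j) t)
                           (*C-ζ^ℤ (E i k) (F k j) t))

  record BlockMonomial (M : Mat (p ℕ.* p)) (E : Fin p → Fin p → Fin p → Fin p → ℤ) : Set where
    constructor blockMonomial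
    field blockEntries : ∀ I j J l → M (combine I j) (combine J l) ≗ ζ^ℤ (E I j J l)
  open BlockMonomial

  block-monomial : ∀ {M E} → BlockMonomial M E → ∀ I J → Monomial (block p M I J) (λ u v → E I u J v)
  block-monomial M-mono I J = monomial λ u v → blockEntries M-mono I u J v

  transpose-blockMonomial : ∀ {M E} → BlockMonomial M E →
                            BlockMonomial (transpose M) (λ I j J l → E J l I j)
  transpose-blockMonomial M-mono = blockMonomial λ I j J l → blockEntries M-mono J l I j

  conjM-blockMonomial : ∀ {M E} → BlockMonomial M E →
                        BlockMonomial (conjM M) (λ I j J l → - E I j J l)
  conjM-blockMonomial {E = E} M-mono = blockMonomial λ I j J l t →
    trans (blockEntries M-mono I j J l _) (conjC-ζ^ℤ (E I j J l) t)

  ᴴ-blockMonomial : ∀ {M E} → BlockMonomial M E → BlockMonomial (M ᴴ) (λ I j J l → - E J l I j)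
  ᴴ-blockMonomial M-mono = conjM-blockMonomial (transpose-blockMonomial M-mono)

  blockMonomial-≗ : ∀ {M N E F} → BlockMonomial M E → BlockMonomial N F →
                    (∀ I j J l → E I j J l ≡ₚ F I j J l) → ∀ x y → M x y ≗ N x y
  blockMonomial-≗ {E = E} {F} M-mono N-mono E≡F = ∀-combine λ I j J l t →
    trans (blockEntries M-mono I j J l t)
          (trans (cong (λ f → f t) (ζ^ℤ-cong (E≡F I j J l))) (sym (blockEntries N-mono I j J l t)))

  *M-blockMonomial : ∀ {M N E F} → BlockMonomial M E → BlockMonomial N F → ∀ I j J l t →
                     (M *M N) (combine I j) (combine J l) t
                     ≡ sumℤ (λ K → sumℤ (λ k → ζ^ℤ (E I j K k + F K k J l) t))
  *M-blockMonomial {M} {N} {E} {F} M-mono N-mono I j J l t = begin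
    (M *M N) x y t                   ≡⟨ sumC-apply (λ z → M x z *C N z y) t ⟩
    sumℤ (λ z → (M x z *C N z y) t)  ≡⟨ sumℤ-combine p p (λ z → (M x z *C N z y) t) ⟩
    sumℤ {p} (λ K → sumℤ {p} (λ k → (M x (combine K k) *C N (combine K k) y) t))
      ≡⟨ sumℤ-cong (λ K → sumℤ-cong (λ k → entry K k)) ⟩
    sumℤ (λ K → sumℤ (λ k → ζ^ℤ (E I j K k + F K k J l) t)) ∎
    where
    open ≡-Reasoning
    x : Fin (p ℕ.* p)
    x = combine I j
    y : Fin (p ℕ.* p)
    y = combine J l
    entry : ∀ K k → (M x (combine K k) *C N (combine K k) y) t ≡ ζ^ℤ (E I j K k + F K k J l) t
    entry K k = trans (*C-cong (blockEntries M-mono I j K k) (blockEntries N-mono K k J l) t)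
                      (*C-ζ^ℤ (E I j K k) (F K k J l) t)

module BushHadamard (p : ℕ) .{{_ : NonZero p}} where
  open ModularArithmetic p
  open Monomials p

  blockExponent : ℤ → Fin p → Fin p → Fin p → Fin p → ℤ
  blockExponent β I j J l = (ι J - ι I) * β * (ι l - ι j)

  blockExponent-cong : ∀ {β β′} → β ≡ₚ β′ → ∀ I j J l → blockExponent β I j J l ≡ₚ blockExponent β′ I j J l
  blockExponent-cong {β} {β′} β≡β′ I j J l =
    ≡ₚ-byFactor ((ι J - ι I) * (ι l - ι j)) (ring (ι J - ι I) β β′ (ι l - ι j)) β≡β′
    where
    ring : ∀ X B B′ Y → X * B * Y - X * B′ * Y ≡ (B - B′) * (X * Y)
    ring = solve-∀

  R-entry : ∀ c j l → R c j l ≗ ζ^ℤ (+ c * (ι l - ι j))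
  R-entry c j l t = begin
    (conjC (ζ^ cj) *C ζ^ cl) t                   ≡⟨ cong₂ (λ u v → (conjC u *C v) t) (ζ^≡ζ^ℤ cj) (ζ^≡ζ^ℤ cl) ⟩
    (conjC (ζ^ℤ (+ cj)) *C ζ^ℤ (+ cl)) t         ≡⟨ *C-congˡ {v = ζ^ℤ (+ cl)} (conjC-ζ^ℤ (+ cj)) t ⟩
    (ζ^ℤ (- + cj) *C ζ^ℤ (+ cl)) t               ≡⟨ *C-ζ^ℤ (- + cj) (+ cl) t ⟩
    ζ^ℤ (- + cj + + cl) t                        ≡⟨ cong (λ e → ζ^ℤ e t) exponent ⟩
    ζ^ℤ (+ c * (ι l - ι j)) t                    ∎
    where
    open ≡-Reasoning
    ring : ∀ C J L → - (C * J) + C * L ≡ C * (L - J)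
    ring = solve-∀
    cj : ℕ
    cj = c ℕ.* toℕ j
    cl : ℕ
    cl = c ℕ.* toℕ l
    exponent : - + cj + + cl ≡ + c * (ι l - ι j)
    exponent = trans (cong₂ (λ u v → - u + v) (ℤ.pos-* c (toℕ j)) (ℤ.pos-* c (toℕ l))) (ring (+ c) (ι j) (ι l))

  B-entry : ∀ b I j J l → B b (combine I j) (combine J l) ≗ ζ^ℤ (blockExponent (+ b) I j J l)
  B-entry b I j J l t = begin
    B b (combine I j) (combine J l) t  ≡⟨ cong (λ R′ → R′ t) B-block ⟩
    R c j l t                          ≡⟨ R-entry c j l t ⟩
    ζ^ℤ (+ c * (ι l - ι j)) t          ≡⟨ cong (λ f → f t) (ζ^ℤ-cong (*-congₚ c≡ₚ (≡ₚ-refl {ι l - ι j}))) ⟩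
    ζ^ℤ (blockExponent (+ b) I j J l) t ∎
    where
    open ≡-Reasoning
    c : ℕ
    c = ((toℕ J ℕ.+ (p ∸ toℕ I)) ℕ.* b) ℕ.% p
    B-block : B b (combine I j) (combine J l) ≡ R c j l
    B-block = cong₂ (λ X Y → R (((toℕ (proj₁ Y) ℕ.+ (p ∸ toℕ (proj₁ X))) ℕ.* b) ℕ.% p) (proj₂ X) (proj₂ Y))
                    (remQuot-combine I j) (remQuot-combine J l)
    c≡ₚ : + c ≡ₚ (ι J - ι I) * + b
    c≡ₚ = ≡ₚ-trans (%ℕ-≡ₚ (+ ((toℕ J ℕ.+ (p ∸ toℕ I)) ℕ.* b)))
            (≡ₚ-trans (≡ₚ-reflexive (ℤ.pos-* (toℕ J ℕ.+ (p ∸ toℕ I)) b))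
              (*-congₚ (m+[p∸n]≡ₚm-n (toℕ J) (ℕ.<⇒≤ (toℕ<n I))) (≡ₚ-refl {+ b})))

  B-blockMonomial : ∀ b → BlockMonomial (B b) (blockExponent (+ b))
  B-blockMonomial b = blockMonomial (B-entry b)

  B-symmetric : ∀ b → Symmetric (B b)
  B-symmetric b = ≗M⇒≈M (blockMonomial-≗ (transpose-blockMonomial (B-blockMonomial b)) (B-blockMonomial b)
    λ I j J l → ≡ₚ-reflexive (ring (ι I) (ι j) (ι J) (ι l) (+ b)))
    where
    ring : ∀ I j J l B → (I - J) * B * (j - l) ≡ (J - I) * B * (l - j)
    ring = solve-∀

  conjM-B : ∀ {b} → b ℕ.≤ p → conjM (B b) ≈M B (p ∸ b)
  conjM-B {b} b≤p =
    ≗M⇒≈M (blockMonomial-≗ (conjM-blockMonomial (B-blockMonomial b)) (B-blockMonomial (p ∸ b)) λ I j J l →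
      ≡ₚ-byFactor ((ι J - ι I) * (ι l - ι j)) (ring (ι J - ι I) (+ b) (+ (p ∸ b)) (ι l - ι j))
                  (≡ₚ-sym (p∸m≡ₚ-m b≤p)))
    where
    ring : ∀ X B B′ Y → - (X * B * Y) - X * B′ * Y ≡ (- B - B′) * (X * Y)
    ring = solve-∀

  [p∸2]b≡ₚ-2b : 2 ℕ.≤ p → ∀ b → + ((p ∸ 2) ℕ.* b) ≡ₚ - (+ 2 * + b)
  [p∸2]b≡ₚ-2b 2≤p b = ≡ₚ-trans (≡ₚ-reflexive (ℤ.pos-* (p ∸ 2) b))
    (≡ₚ-trans (*-congₚ (p∸m≡ₚ-m 2≤p) (≡ₚ-refl {+ b})) (≡ₚ-reflexive (ring (+ 2) (+ b))))
    where
    ring : ∀ T B → - T * B ≡ - (T * B)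
    ring = solve-∀

  B-2b≗conjM-B : 2 ℕ.≤ p → ∀ b x y → B (2 ℕ.* b) x y ≗ conjM (B ((p ∸ 2) ℕ.* b)) x y
  B-2b≗conjM-B 2≤p b =
    blockMonomial-≗ (B-blockMonomial (2 ℕ.* b)) (conjM-blockMonomial (B-blockMonomial ((p ∸ 2) ℕ.* b)))
      λ I j J l → ≡ₚ-trans (≡ₚ-reflexive (cong (λ β → blockExponent β I j J l) (ℤ.pos-* 2 b)))
        (≡ₚ-byFactor ((ι J - ι I) * (ι l - ι j)) (ring (ι J - ι I) (+ b) (+ ((p ∸ 2) ℕ.* b)) (ι l - ι j))
                     ([p∸2]b≡ₚ-2b 2≤p b))
    where
    ring : ∀ X B C Y → X * (+ 2 * B) * Y - - (X * C * Y) ≡ (C - - (+ 2 * B)) * (X * Y)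
    ring = solve-∀

  B-entries : ∀ b x y → ∃ λ (e : Fin p) → B b x y ≈ ζ^ (toℕ e)
  B-entries b = ∀-combine λ I j J l → residue (blockExponent (+ b) I j J l) , ≗⇒≈ λ t →
    trans (B-entry b I j J l t)
          (cong (λ f → f t) (trans (ζ^ℤ-cong (≡ₚ-sym (residue-≡ₚ _))) (sym (ζ^≡ζ^ℤ _))))

  bushEntry-≈ : ∀ (I J u v : Fin p) (s : Cyc p) → (I ≡ J → ∀ t → s t ≡ + p * ζ^ℤ 0ℤ t) →
                (I ≢ J → ∀ t → s t ≡ 1ℤ) → s ≈ (δ I J ·M (p ·M allOnes)) u v
  bushEntry-≈ I J u v s diagonal offDiagonal = byCases (I ≟ J)
    where
    open ≡-Reasoning
    byCases : Dec (I ≡ J) → s ≈ (δ I J ·M (p ·M allOnes)) u v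
    byCases (yes refl) = ≗⇒≈ λ t → begin
      s t                        ≡⟨ diagonal refl t ⟩
      + p * ζ^ℤ 0ℤ t             ≡⟨ cong (λ f → + p * f t) (ζ^≡ζ^ℤ 0) ⟨
      + p * ζ^ 0 t               ≡⟨ ℤ.*-identityˡ _ ⟨
      1ℤ * (+ p * ζ^ 0 t)        ≡⟨ cong (λ d → + d * (+ p * ζ^ 0 t)) (δ-diagonal I) ⟨
      + δ I I * (+ p * ζ^ 0 t)   ∎
    byCases (no I≢J) = constant-≈ {d = 0ℤ} (offDiagonal I≢J) λ t →
      cong (λ d → + d * (+ p * ζ^ 0 t)) (δ-offDiagonal I≢J)

  BBᴴ-diagonal : ∀ b I j t → (B b *M (B b ᴴ)) (combine I j) (combine I j) t ≡ + (p ℕ.* p) * ζ^ 0 t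
  BBᴴ-diagonal b I j t = begin
    (B b *M (B b ᴴ)) (combine I j) (combine I j) t
      ≡⟨ *M-blockMonomial (B-blockMonomial b) (ᴴ-blockMonomial (B-blockMonomial b)) I j I j t ⟩
    sumℤ (λ K → sumℤ (λ k → ζ^ℤ (E K k - E K k) t))
      ≡⟨ sumℤ-cong {p} (λ K → sum-ζ^ℤ-constant (λ k → ≡ₚ-reflexive (ℤ.+-inverseʳ (E K k))) t) ⟩
    sumℤ {p} (λ K → + p * ζ^ℤ 0ℤ t)
      ≡⟨ sumℤ-const p _ ⟩
    + p * (+ p * ζ^ℤ 0ℤ t)
      ≡⟨ ℤ.*-assoc (+ p) (+ p) _ ⟨
    + p * + p * ζ^ℤ 0ℤ t
      ≡⟨ cong₂ _*_ (ℤ.pos-* p p) (cong (λ f → f t) (ζ^≡ζ^ℤ 0)) ⟨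
    + (p ℕ.* p) * ζ^ 0 t ∎
    where
    open ≡-Reasoning
    E : Fin p → Fin p → ℤ
    E = blockExponent (+ b) I j

  module _ (p-prime : Prime p) {b} (b≢0 : + b ≢ₚ 0ℤ) where

    allOnes*block : ∀ I J → (allOnes *M block p (B b) I J) ≈M (δ I J ·M (p ·M allOnes))
    allOnes*block I J u v = bushEntry-≈ I J u v ((allOnes *M block p (B b) I J) u v)
      (λ { refl t → trans (entry t)
                          (sum-ζ^ℤ-constant (λ k → ≡ₚ-reflexive (ring₀ (ι I) (+ b) (ι k) (ι v))) t) })
      (λ I≢J t → trans (entry t) (sum-ζ^ℤ-affine p-prime (*-≢ₚ0 p-prime (ι-≢ₚ I≢J) b≢0)
                                   (λ k → ≡ₚ-reflexive (ring₁ (ι I) (ι J) (+ b) (ι k) (ι v))) t))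
      where
      entry : ∀ t → (allOnes *M block p (B b) I J) u v t
                    ≡ sumℤ (λ k → ζ^ℤ (0ℤ + blockExponent (+ b) I k J v) t)
      entry = *M-monomial allOnes-monomial (block-monomial (B-blockMonomial b) I J) u v
      ring₀ : ∀ I B K V → 0ℤ + (I - I) * B * (V - K) ≡ 0ℤ
      ring₀ = solve-∀
      ring₁ : ∀ I J B K V → 0ℤ + (J - I) * B * (V - K) ≡ (I - J) * B * K + (J - I) * B * V
      ring₁ = solve-∀

    block*allOnes : ∀ I J → (block p (B b) I J *M allOnes) ≈M (δ I J ·M (p ·M allOnes))
    block*allOnes I J u v = bushEntry-≈ I J u v ((block p (B b) I J *M allOnes) u v)
      (λ { refl t → trans (entry t)
                          (sum-ζ^ℤ-constant (λ k → ≡ₚ-reflexive (ring₀ (ι I) (+ b) (ι k) (ι u))) t) })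
      (λ I≢J t → trans (entry t) (sum-ζ^ℤ-affine p-prime (*-≢ₚ0 p-prime (ι-≢ₚ (I≢J ∘ sym)) b≢0)
                                   (λ k → ≡ₚ-reflexive (ring₁ (ι I) (ι J) (+ b) (ι k) (ι u))) t))
      where
      entry : ∀ t → (block p (B b) I J *M allOnes) u v t
                    ≡ sumℤ (λ k → ζ^ℤ (blockExponent (+ b) I u J k + 0ℤ) t)
      entry = *M-monomial (block-monomial (B-blockMonomial b) I J) allOnes-monomial u v
      ring₀ : ∀ I B K U → (I - I) * B * (K - U) + 0ℤ ≡ 0ℤ
      ring₀ = solve-∀
      ring₁ : ∀ I J B K U → (J - I) * B * (K - U) + 0ℤ ≡ (J - I) * B * K + - ((J - I) * B * U)
      ring₁ = solve-∀

    B-bushType : BushType p (B b)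
    B-bushType I J = allOnes*block I J , block*allOnes I J

    BBᴴ-offDiagonal : ∀ I j J l → combine I j ≢ combine J l → ∀ t →
                      (B b *M (B b ᴴ)) (combine I j) (combine J l) t ≡ + p * 1ℤ
    BBᴴ-offDiagonal I j J l x≢y t =
      trans (*M-blockMonomial (B-blockMonomial b) (ᴴ-blockMonomial (B-blockMonomial b)) I j J l t)
            (sum (I ≟ J))
      where
      E : Fin p → Fin p → Fin p → Fin p → ℤ
      E = blockExponent (+ b)
      ring₁ : ∀ I J K j l k B → (K - I) * B * (k - j) - (K - J) * B * (k - l)
                                ≡ (J - I) * B * k + (- ((K - I) * B * j) + (K - J) * B * l)
      ring₁ = solve-∀
      ring₂ : ∀ I K j l k B → (K - I) * B * (k - j) - (K - I) * B * (k - l)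
                              ≡ B * (l - j) * K + - (I * B * (l - j))
      ring₂ = solve-∀
      sum : Dec (I ≡ J) → sumℤ {p} (λ K → sumℤ {p} (λ k → ζ^ℤ (E I j K k - E J l K k) t)) ≡ + p * 1ℤ
      sum (no I≢J) = trans
        (sumℤ-cong {p} λ K → sum-ζ^ℤ-affine p-prime (*-≢ₚ0 p-prime (ι-≢ₚ (I≢J ∘ sym)) b≢0)
                           (λ k → ≡ₚ-reflexive (ring₁ (ι I) (ι J) (ι K) (ι j) (ι l) (ι k) (+ b))) t)
        (sumℤ-const p 1ℤ)
      sum (yes refl) = begin
        sumℤ {p} (λ K → sumℤ {p} (λ k → ζ^ℤ (E I j K k - E I l K k) t))
          ≡⟨ sumℤ-cong {p} (λ K → sum-ζ^ℤ-constant
                 (λ k → ≡ₚ-reflexive (ring₂ (ι I) (ι K) (ι j) (ι l) (ι k) (+ b))) t) ⟩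
        sumℤ {p} (λ K → + p * ζ^ℤ (+ b * (ι l - ι j) * ι K + - (ι I * + b * (ι l - ι j))) t)
          ≡⟨ sumℤ-*ˡ {p} (+ p) _ ⟩
        + p * sumℤ {p} (λ K → ζ^ℤ (+ b * (ι l - ι j) * ι K + - (ι I * + b * (ι l - ι j))) t)
          ≡⟨ cong (λ z → + p * z)
                  (sum-ζ^ℤ-affine p-prime (*-≢ₚ0 p-prime b≢0 (ι-≢ₚ (j≢l ∘ sym))) (λ K → ≡ₚ-refl) t) ⟩
        + p * 1ℤ ∎
        where
        open ≡-Reasoning
        j≢l : j ≢ l
        j≢l refl = x≢y refl

    B-orthogonal : (B b *M (B b ᴴ)) ≈M ((p ℕ.* p) ·M idM)
    B-orthogonal = ∀-combine λ I j J l → entry I j J l (combine I j ≟ combine J l)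
      where
      entry : ∀ I j J l → Dec (combine I j ≡ combine J l) →
              (B b *M (B b ᴴ)) (combine I j) (combine J l) ≈ ((p ℕ.* p) ·M idM) (combine I j) (combine J l)
      entry I j J l (no x≢y) = constant-≈ (BBᴴ-offDiagonal I j J l x≢y) λ t →
        trans (cong (λ u → + (p ℕ.* p) * u t) (idM-offDiagonal x≢y)) (ℤ.*-zeroʳ (+ (p ℕ.* p)))
      entry I j J l (yes x≡y) with combine-injective I j J l x≡y
      ... | refl , refl = ≗⇒≈ λ t →
        trans (BBᴴ-diagonal b I j t) (cong (λ u → + (p ℕ.* p) * u t) (sym (idM-diagonal (combine I j))))

    B-BH : BH (p ℕ.* p) (B b)
    B-BH = B-entries b , B-orthogonal

    module _ (I j J l : Fin p) where

      productExponent : Fin p → Fin p → ℤ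
      productExponent K k = blockExponent (+ b) I j K k + blockExponent (+ ((p ∸ 2) ℕ.* b)) K k J l

      private
        X₀ : ℤ
        X₀ = + 2 * ι J - ι I
        K₀ : Fin p
        K₀ = residue X₀
        f : ℤ → Fin p → ℤ
        f X k = (X - ι I) * + b * (ι k - ι j) + (ι J - X) * - (+ 2 * + b) * (ι l - ι k)

      productExponent≡ₚf : ∀ K k → productExponent K k ≡ₚ f (ι K) k
      productExponent≡ₚf K k = +-congₚ (≡ₚ-refl {blockExponent (+ b) I j K k})
                                       (blockExponent-cong ([p∸2]b≡ₚ-2b (prime⇒2≤p p-prime) b) K k J l)

      -- The slope b (2J - I - K) vanishes only at K₀.
      productExponent-affine : ∀ K k → productExponent K k ≡ₚ
        + b * (X₀ - ι K) * ι k + (- ((ι K - ι I) * + b * ι j) + (ι J - ι K) * - (+ 2 * + b) * ι l)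
      productExponent-affine K k = ≡ₚ-trans (productExponent≡ₚf K k)
        (≡ₚ-reflexive (ring (ι K) (ι I) (ι J) (ι j) (ι l) (ι k) (+ b)))
        where
        ring : ∀ X I J j l k B → (X - I) * B * (k - j) + (J - X) * - (+ 2 * B) * (l - k)
                                 ≡ B * (+ 2 * J - I - X) * k + (- ((X - I) * B * j) + (J - X) * - (+ 2 * B) * l)
        ring = solve-∀

      productExponent-K₀ : ∀ k → productExponent K₀ k ≡ₚ blockExponent (+ 2 * + b) I j J l
      productExponent-K₀ k = ≡ₚ-trans (productExponent≡ₚf K₀ k)
        (≡ₚ-byFactor _ (ring (ι K₀) (ι I) (ι J) (ι j) (ι l) (ι k) (+ b)) (residue-≡ₚ X₀))
        where
        ring : ∀ X I J j l k B → (X - I) * B * (k - j) + (J - X) * - (+ 2 * B) * (l - k)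
                                  - (J - I) * (+ 2 * B) * (l - j)
                                 ≡ (X - (+ 2 * J - I)) * (B * (k - j) + + 2 * B * (l - k))
        ring = solve-∀

      B-product-entry : ∀ t → (B b *M B ((p ∸ 2) ℕ.* b)) (combine I j) (combine J l) t
                              ≡ + p * ζ^ℤ (blockExponent (+ (2 ℕ.* b)) I j J l) t + (+ p * 1ℤ - 1ℤ)
      B-product-entry t = begin
        (B b *M B ((p ∸ 2) ℕ.* b)) (combine I j) (combine J l) t
          ≡⟨ *M-blockMonomial (B-blockMonomial b) (B-blockMonomial ((p ∸ 2) ℕ.* b)) I j J l t ⟩
        sumℤ inner
          ≡⟨ sumℤ-except inner K₀ 1ℤ inner-off ⟩
        inner K₀ + (+ p * 1ℤ - 1ℤ)
          ≡⟨ cong (_+ (+ p * 1ℤ - 1ℤ)) (sum-ζ^ℤ-constant productExponent-K₀ t) ⟩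
        + p * ζ^ℤ (blockExponent (+ 2 * + b) I j J l) t + (+ p * 1ℤ - 1ℤ)
          ≡⟨ cong (λ β → + p * ζ^ℤ (blockExponent β I j J l) t + (+ p * 1ℤ - 1ℤ)) (ℤ.pos-* 2 b) ⟨
        + p * ζ^ℤ (blockExponent (+ (2 ℕ.* b)) I j J l) t + (+ p * 1ℤ - 1ℤ) ∎
        where
        open ≡-Reasoning
        inner : Fin p → ℤ
        inner K = sumℤ (λ k → ζ^ℤ (productExponent K k) t)
        inner-off : ∀ K → K ≢ K₀ → inner K ≡ 1ℤ
        inner-off K K≢K₀ = sum-ζ^ℤ-affine p-prime (*-≢ₚ0 p-prime b≢0 slope≢0) (productExponent-affine K) t
          where
          slope≢0 : X₀ - ι K ≢ₚ 0ℤ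
          slope≢0 X₀≡K = K≢K₀ (≡ₚ⇒≡residue {K} {X₀} (≡ₚ-sym (congruent (≡ₚ0⇒∣ X₀≡K))))

    B-product : (B b *M B ((p ∸ 2) ℕ.* b)) ≈M (p ·M B (2 ℕ.* b))
    B-product = ∀-combine λ I j J l → ≡+c⇒≈ (+ p * 1ℤ - 1ℤ) λ t →
      trans (B-product-entry I j J l t)
            (cong (λ z → + p * z + (+ p * 1ℤ - 1ℤ)) (sym (B-entry (2 ℕ.* b) I j J l t)))

proposition4p9 : (p : ℕ) .{{_ : NonZero p}} → Prime p → p ℕ.% 2 ≡ 1 →
    (a : ℕ) → 1 ℕ.≤ a → a ℕ.≤ p ∸ 1 →
      Symmetric (B {p} a)
      × BushType p (B a)
      × BH (p ℕ.* p) (B a)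
      × (conjM (B a) ≈M B (p ∸ a))
      × ((B a *M B ((p ∸ 2) ℕ.* a)) ≈M (p ·M B (2 ℕ.* a)))
      × ((p ·M B (2 ℕ.* a)) ≈M (p ·M conjM (B ((p ∸ 2) ℕ.* a))))
proposition4p9 p p-prime _ a 1≤a a≤p∸1 =
    B-symmetric a
  , B-bushType p-prime a≢0
  , B-BH p-prime a≢0
  , conjM-B (ℕ.≤pred⇒≤ a≤p∸1)
  , B-product p-prime a≢0
  , λ x y → ≗⇒≈ λ t → cong (λ z → + p * z) (B-2b≗conjM-B (prime⇒2≤p p-prime) a x y t)
  where
  open ModularArithmetic p
  open Monomials p
  open BushHadamard p
  a≢0 : + a ≢ₚ 0ℤ
  a≢0 = 0<m<p⇒≢ₚ0 1≤a (ℕ.m≤pred[n]⇒suc[m]≤n a≤p∸1)
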